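{- As formal power series in $z,t$, $$\sum_{m\ge0}\sum_{k\ge0}T_{4\times m}(2,k)z^mt^k=\frac{1-zt}{1-z-zt-2z^2t-z^2t^2+z^3t^2+z^3t^3}.$$
   Context: $T_{n\times m}(s,k)$ denotes the number of tilings of an $n\times m$ rectangle (width $n$, length $m$, unit grid) by exactly $k$ non-overlapping grid-aligned $s\times s$ squares and $nm-ks^2$ unit squares, with rotations/reflections counted as distinct; for $m=0$ the only tiling is the empty one with $k=0$. -}

module Defs where

open import Data.Bool using (Bool; true; false; _∧_; _∨_; not; if_then_else_)
open import Data.Nat using (ℕ; zero; suc; _+_; _∸_; _≤ᵇ_; _<ᵇ_; _≡ᵇ_)
open import Data.Fin using (Fin; toℕ)
open import Data.Product using (_×_; _,_)
open import Data.List using (List; []; _∷_; map; concatMap; length; filterᵇ; allFin; cartesianProduct; foldr)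
open import Data.Vec using (Vec; []; _∷_; lookup)
open import Data.Integer using (ℤ; +_; -_; _*_) renaming (_+_ to _+ℤ_)

-- Tilings of an n × m rectangle by s × s squares and unit squares.
--
-- Such a tiling is determined by the set of s×s squares it uses (the
-- remaining cells are forced to be unit squares).  We record an s×s
-- square by the cell (row r, column c) of its corner with smallest
-- coordinates; it occupies rows r..r+s-1 and columns c..c+s-1.
-- A "placement" is an n × m Boolean grid marking these corner cells.

allᵇ : {A : Set} → (A → Bool) → List A → Bool
allᵇ p = foldr (λ x b → p x ∧ b) true

Grid : ℕ → ℕ → Set
Grid n m = Vec (Vec Bool m) n

allVecs : {A : Set} → List A → (n : ℕ) → List (Vec A n)
allVecs xs zero    = [] ∷ []
allVecs xs (suc n) = concatMap (λ x → map (x ∷_) (allVecs xs n)) xs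

allGrids : (n m : ℕ) → List (Grid n m)
allGrids n m = allVecs (allVecs (true ∷ false ∷ []) m) n

Cell : ℕ → ℕ → Set
Cell n m = Fin n × Fin m

cells : (n m : ℕ) → List (Cell n m)
cells n m = cartesianProduct (allFin n) (allFin m)

chosen : {n m : ℕ} → Grid n m → Cell n m → Bool
chosen g (r , c) = lookup (lookup g r) c

fits : (n m s : ℕ) → {n' m' : ℕ} → Fin n' × Fin m' → Bool
fits n m s (r , c) = ((toℕ r + s) ≤ᵇ n) ∧ ((toℕ c + s) ≤ᵇ m)

overlaps : (s : ℕ) → {n m : ℕ} → Cell n m → Cell n m → Bool
overlaps s (r , c) (r' , c') =
  (toℕ r <ᵇ toℕ r' + s) ∧ (toℕ r' <ᵇ toℕ r + s) ∧
  (toℕ c <ᵇ toℕ c' + s) ∧ (toℕ c' <ᵇ toℕ c + s)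

sameCell : {n m : ℕ} → Cell n m → Cell n m → Bool
sameCell (r , c) (r' , c') = (toℕ r ≡ᵇ toℕ r') ∧ (toℕ c ≡ᵇ toℕ c')

numChosen : {n m : ℕ} → Grid n m → ℕ
numChosen {n} {m} g = length (filterᵇ (chosen g) (cells n m))

isTiling : (n m s k : ℕ) → Grid n m → Bool
isTiling n m s k g =
  allᵇ (λ p → not (chosen g p) ∨ fits n m s p) (cells n m) ∧
  allᵇ (λ pq → not (chosen g (Data.Product.proj₁ pq) ∧ chosen g (Data.Product.proj₂ pq)
                    ∧ not (sameCell (Data.Product.proj₁ pq) (Data.Product.proj₂ pq))
                    ∧ overlaps s (Data.Product.proj₁ pq) (Data.Product.proj₂ pq)))
      (cartesianProduct (cells n m) (cells n m)) ∧
  (numChosen g ≡ᵇ k)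

Tnm : (n m s k : ℕ) → ℕ
Tnm n m s k = length (filterᵇ (isTiling n m s k) (allGrids n m))

-- Formal power series in z, t with integer coefficients:
-- f m k is the coefficient of z^m t^k.

Series : Set
Series = ℕ → ℕ → ℤ

sumTo : ℕ → (ℕ → ℤ) → ℤ
sumTo zero    f = f 0
sumTo (suc n) f = sumTo n f +ℤ f (suc n)

_⋆_ : Series → Series → Series
(f ⋆ g) m k = sumTo m (λ i → sumTo k (λ j → f i j * g (m ∸ i) (k ∸ j)))

F4 : Series
F4 m k = + Tnm 4 m 2 k

Den : Series
Den 0 0 = + 1
Den 1 0 = - + 1
Den 1 1 = - + 1
Den 2 1 = - + 2
Den 2 2 = - + 1
Den 3 2 = + 1
Den 3 3 = + 1
Den _ _ = + 0

Num : Series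
Num 0 0 = + 1
Num 1 1 = - + 1
Num _ _ = + 0

-- Record a placement by the corners of its 2×2 squares, column by column. A 2×2 square reaches
-- only into the next column, so whether a placement of the remaining columns can follow depends
-- only on the column of corners just before it: the tilings of an n-row strip obey a
-- transfer-matrix recursion over columns. For four rows the only columns
-- that occur have no corner, one corner in row 0, 1 or 2, or corners in rows 0 and 2. Let flat m k
-- count the tilings that follow an empty column (so flat m k = T_{4×m}(2,k)) and notched m k those
-- that follow a single corner in row 0 or in row 2. For m ≥ 2 the recursion gives
--   flat m k    = flat (m-1) k + flat (m-2) (k-1) + flat (m-2) (k-2) + notched (m-1) (k-1),
--   notched m k = notched (m-1) (k-1) + 2 flat (m-1) k,
-- with terms of negative index read as 0. Eliminating notched shows that the coefficient of
-- z^m t^k in Den · Σ flat m k z^m t^k vanishes for m ≥ 3; for m ≤ 2 it is computed directly.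

module Submission where

open import Algebra.Bundles using (CommutativeMonoid)
open import Data.Bool using (Bool; true; false; _∧_; _∨_; not; if_then_else_)
open import Data.Bool.Properties using (∧-commutativeMonoid; ∧-zeroʳ; ∧-identityʳ)
open import Data.Fin using (Fin; toℕ) renaming (zero to fzero; suc to fsuc)
open import Data.List using (List; []; _∷_; _++_; map; concatMap; foldr; tabulate; allFin; cartesianProduct; length; filterᵇ)
import Data.List.Properties as List
open import Data.Nat using (ℕ; zero; suc; _+_; _*_; _∸_; _≤_; z≤n; s≤s; _≤ᵇ_; _<ᵇ_; _≡ᵇ_)
open import Data.Integer using (ℤ; +_; +0)
import Data.Integer as ℤ
import Data.Integer.Properties as ℤP
open import Data.Nat.Properties using (+-0-commutativeMonoid; +-identityʳ; +-suc; +-comm; ≤-refl; m≤n⇒m≤1+n; m∸[m∸n]≡n)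
open import Data.Product using (_×_; _,_; proj₁; proj₂)
open import Data.Vec using (Vec; []; _∷_; lookup; zipWith; replicate)
open import Data.Vec.Properties using (lookup-zipWith; lookup-replicate)
open import Function using (_∘_)
import Data.Nat.Tactic.RingSolver as ℕ-Solver
import Data.Integer.Tactic.RingSolver as ℤ-Solver
import Relation.Binary.PropositionalEquality as ≡

open import Defs

shiftCell : ∀ {n m} → Cell n m → Cell n (suc m)
shiftCell p = proj₁ p , fsuc (proj₂ p)

module BigOperator {c ℓ} (M : CommutativeMonoid c ℓ) where

  open CommutativeMonoid M
  open import Relation.Binary.Reasoning.Setoid setoid
  open import Algebra.Properties.CommutativeSemigroup commutativeSemigroup using (interchange)

  ⨁ : {A : Set} → (A → Carrier) → List A → Carrier
  ⨁ f = foldr (λ x acc → f x ∙ acc) ε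

  ⨁-cong : {A : Set} {f g : A → Carrier} → (∀ x → f x ≈ g x) → ∀ xs → ⨁ f xs ≈ ⨁ g xs
  ⨁-cong f≈g []       = refl
  ⨁-cong f≈g (x ∷ xs) = ∙-cong (f≈g x) (⨁-cong f≈g xs)

  ⨁-ε : {A : Set} (xs : List A) → ⨁ (λ _ → ε) xs ≈ ε
  ⨁-ε []       = refl
  ⨁-ε (x ∷ xs) = trans (identityˡ _) (⨁-ε xs)

  ⨁-++ : {A : Set} (f : A → Carrier) (xs ys : List A) → ⨁ f (xs ++ ys) ≈ ⨁ f xs ∙ ⨁ f ys
  ⨁-++ f []       ys = sym (identityˡ _)
  ⨁-++ f (x ∷ xs) ys = trans (∙-congˡ (⨁-++ f xs ys)) (sym (assoc _ _ _))

  ⨁-map : {A B : Set} (f : B → Carrier) (g : A → B) (xs : List A) → ⨁ f (map g xs) ≈ ⨁ (f ∘ g) xs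
  ⨁-map f g []       = refl
  ⨁-map f g (x ∷ xs) = ∙-congˡ (⨁-map f g xs)

  ⨁-∙ : {A : Set} (f g : A → Carrier) (xs : List A) → ⨁ (λ x → f x ∙ g x) xs ≈ ⨁ f xs ∙ ⨁ g xs
  ⨁-∙ f g []       = sym (identityˡ _)
  ⨁-∙ f g (x ∷ xs) = trans (∙-congˡ (⨁-∙ f g xs)) (interchange _ _ _ _)

  ⨁-concatMap : {A B : Set} (f : B → Carrier) (g : A → List B) (xs : List A) →
                ⨁ f (concatMap g xs) ≈ ⨁ (λ x → ⨁ f (g x)) xs
  ⨁-concatMap f g []       = refl
  ⨁-concatMap f g (x ∷ xs) = trans (⨁-++ f (g x) (concatMap g xs)) (∙-congˡ (⨁-concatMap f g xs))

  ⨁-cartesianProduct : {A B : Set} (f : A × B → Carrier) (xs : List A) (ys : List B) →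
                       ⨁ f (cartesianProduct xs ys) ≈ ⨁ (λ x → ⨁ (λ y → f (x , y)) ys) xs
  ⨁-cartesianProduct f []       ys = refl
  ⨁-cartesianProduct f (x ∷ xs) ys = begin
    ⨁ f (map (x ,_) ys ++ cartesianProduct xs ys)       ≈⟨ ⨁-++ f (map (x ,_) ys) _ ⟩
    ⨁ f (map (x ,_) ys) ∙ ⨁ f (cartesianProduct xs ys)  ≈⟨ ∙-cong (⨁-map f (x ,_) ys) (⨁-cartesianProduct f xs ys) ⟩
    ⨁ (λ y → f (x , y)) ys ∙ ⨁ (λ x → ⨁ (λ y → f (x , y)) ys) xs ∎

  ⨁-comm : {A B : Set} (f : A → B → Carrier) (xs : List A) (ys : List B) →
           ⨁ (λ x → ⨁ (f x) ys) xs ≈ ⨁ (λ y → ⨁ (λ x → f x y) xs) ys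
  ⨁-comm f []       ys = sym (⨁-ε ys)
  ⨁-comm f (x ∷ xs) ys = trans (∙-congˡ (⨁-comm f xs ys)) (sym (⨁-∙ (f x) _ ys))

  ⨁-allFin-suc : ∀ {n} (f : Fin (suc n) → Carrier) → ⨁ f (allFin (suc n)) ≈ f fzero ∙ ⨁ (f ∘ fsuc) (allFin n)
  ⨁-allFin-suc {n} f = ∙-congˡ (begin
    ⨁ f (tabulate fsuc)         ≡⟨ ≡.cong (⨁ f) (≡.sym (List.map-tabulate (λ i → i) fsuc)) ⟩
    ⨁ f (map fsuc (allFin n))   ≈⟨ ⨁-map f fsuc (allFin n) ⟩
    ⨁ (f ∘ fsuc) (allFin n)     ∎)

  ⨁-cells-zero : ∀ {n} (f : Cell n 0 → Carrier) → ⨁ f (cells n 0) ≈ ε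
  ⨁-cells-zero {n} f = trans (⨁-cartesianProduct f (allFin n) []) (⨁-ε (allFin n))

  ⨁-cells-suc : ∀ {n m} (f : Cell n (suc m) → Carrier) →
                ⨁ f (cells n (suc m)) ≈ ⨁ (λ r → f (r , fzero)) (allFin n) ∙ ⨁ (f ∘ shiftCell) (cells n m)
  ⨁-cells-suc {n} {m} f = begin
    ⨁ f (cells n (suc m))
      ≈⟨ ⨁-cartesianProduct f (allFin n) (allFin (suc m)) ⟩
    ⨁ (λ r → ⨁ (λ c → f (r , c)) (allFin (suc m))) (allFin n)
      ≈⟨ ⨁-cong (λ r → ⨁-allFin-suc (λ c → f (r , c))) (allFin n) ⟩
    ⨁ (λ r → f (r , fzero) ∙ ⨁ (λ c → f (r , fsuc c)) (allFin m)) (allFin n)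
      ≈⟨ ⨁-∙ _ _ (allFin n) ⟩
    ⨁ (λ r → f (r , fzero)) (allFin n) ∙ ⨁ (λ r → ⨁ (λ c → f (r , fsuc c)) (allFin m)) (allFin n)
      ≈⟨ ∙-congˡ (sym (⨁-cartesianProduct _ (allFin n) (allFin m))) ⟩
    ⨁ (λ r → f (r , fzero)) (allFin n) ∙ ⨁ (f ∘ shiftCell) (cells n m) ∎

  ⨁-allVecs-suc : ∀ {A : Set} {n} (f : Vec A (suc n) → Carrier) (xs : List A) →
                  ⨁ f (allVecs xs (suc n)) ≈ ⨁ (λ x → ⨁ (λ w → f (x ∷ w)) (allVecs xs n)) xs
  ⨁-allVecs-suc {n = n} f xs =
    trans (⨁-concatMap f _ xs) (⨁-cong (λ x → ⨁-map f (x ∷_) (allVecs xs n)) xs)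

  ⨁-allGrids-suc : ∀ {A : Set} {m} n (f : Vec (Vec A (suc m)) n → Carrier) (xs : List A) →
    ⨁ f (allVecs (allVecs xs (suc m)) n) ≈ ⨁ (λ v → ⨁ (λ g → f (zipWith _∷_ v g)) (allVecs (allVecs xs m) n)) (allVecs xs n)
  ⨁-allGrids-suc zero    f xs = sym (identityʳ _)
  ⨁-allGrids-suc {m = m} (suc n) f xs = begin
    ⨁ f (allVecs rows′ (suc n))
      ≈⟨ ⨁-allVecs-suc f rows′ ⟩
    ⨁ (λ r → ⨁ (λ w → f (r ∷ w)) (allVecs rows′ n)) rows′
      ≈⟨ ⨁-allVecs-suc _ xs ⟩
    ⨁ (λ x → ⨁ (λ r → ⨁ (λ w → f ((x ∷ r) ∷ w)) (allVecs rows′ n)) rows) xs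
      ≈⟨ ⨁-cong (λ x → ⨁-cong (λ r → ⨁-allGrids-suc n (λ w → f ((x ∷ r) ∷ w)) xs) rows) xs ⟩
    ⨁ (λ x → ⨁ (λ r → ⨁ (λ v → ⨁ (λ g → f ((x ∷ r) ∷ zipWith _∷_ v g)) (allVecs rows n)) (allVecs xs n)) rows) xs
      ≈⟨ ⨁-cong (λ x → ⨁-comm _ rows (allVecs xs n)) xs ⟩
    ⨁ (λ x → ⨁ (λ v → ⨁ (λ r → ⨁ (λ g → f ((x ∷ r) ∷ zipWith _∷_ v g)) (allVecs rows n)) rows) (allVecs xs n)) xs
      ≈⟨ ⨁-cong (λ x → ⨁-cong (λ v → sym (⨁-allVecs-suc (λ g → f (zipWith _∷_ (x ∷ v) g)) rows)) (allVecs xs n)) xs ⟩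
    ⨁ (λ x → ⨁ (λ v → ⨁ (λ g → f (zipWith _∷_ (x ∷ v) g)) (allVecs rows (suc n))) (allVecs xs n)) xs
      ≈⟨ sym (⨁-allVecs-suc _ xs) ⟩
    ⨁ (λ v → ⨁ (λ g → f (zipWith _∷_ v g)) (allVecs rows (suc n))) (allVecs xs (suc n)) ∎
    where
    rows′ = allVecs xs (suc m)
    rows  = allVecs xs m

open import Relation.Binary.PropositionalEquality

module ⋀ = BigOperator ∧-commutativeMonoid
module ∑ = BigOperator +-0-commutativeMonoid

indicator : Bool → ℕ
indicator b = if b then 1 else 0

count : {A : Set} → (A → Bool) → List A → ℕ
count p = ∑.⨁ (indicator ∘ p)

length-filterᵇ : {A : Set} (p : A → Bool) (xs : List A) → length (filterᵇ p xs) ≡ count p xs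
length-filterᵇ p []       = refl
length-filterᵇ p (x ∷ xs) with p x
... | true  = cong suc (length-filterᵇ p xs)
... | false = length-filterᵇ p xs

count-∧ˡ : {A : Set} (b : Bool) (p : A → Bool) (xs : List A) →
           count (λ x → b ∧ p x) xs ≡ (if b then count p xs else 0)
count-∧ˡ true  p xs = refl
count-∧ˡ false p xs = ∑.⨁-ε xs

suc-≤ᵇ-suc : ∀ a b → (suc a ≤ᵇ suc b) ≡ (a ≤ᵇ b)
suc-≤ᵇ-suc zero    b = refl
suc-≤ᵇ-suc (suc a) b = refl

+-≡ᵇ : ∀ a b k → (a + b ≡ᵇ k) ≡ (a ≤ᵇ k) ∧ (b ≡ᵇ k ∸ a)
+-≡ᵇ zero    b k       = refl
+-≡ᵇ (suc a) b zero    = refl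
+-≡ᵇ (suc a) b (suc k) = trans (+-≡ᵇ a b k) (cong (_∧ (b ≡ᵇ k ∸ a)) (sym (suc-≤ᵇ-suc a k)))

≤⇒≤ᵇ≡true : ∀ {d n} → d ≤ n → (d ≤ᵇ n) ≡ true
≤⇒≤ᵇ≡true z≤n               = refl
≤⇒≤ᵇ≡true (s≤s {m} {n} d≤n) = trans (suc-≤ᵇ-suc m n) (≤⇒≤ᵇ≡true d≤n)

suc[n+i]≤ᵇn≡false : ∀ n i → (suc (n + i) ≤ᵇ n) ≡ false
suc[n+i]≤ᵇn≡false zero    i = refl
suc[n+i]≤ᵇn≡false (suc n) i = suc[n+i]≤ᵇn≡false n i

not-∧-false : ∀ a b c x y → not (a ∧ (b ∧ (c ∧ (x ∧ (y ∧ false))))) ≡ true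
not-∧-false a b c x y rewrite ∧-zeroʳ y | ∧-zeroʳ x | ∧-zeroʳ c | ∧-zeroʳ b | ∧-zeroʳ a = refl

allVecs-singleton : {A : Set} (x : A) (n : ℕ) → allVecs (x ∷ []) n ≡ replicate n x ∷ []
allVecs-singleton x zero    = refl
allVecs-singleton x (suc n) rewrite allVecs-singleton x n = refl

-- Placements in strips of n rows, built column by column

Column : ℕ → Set
Column n = Vec Bool n

infixr 5 _▹_
_▹_ : ∀ {n m} → Column n → Grid n m → Grid n (suc m)
v ▹ g = zipWith _∷_ v g

emptyGrid : ∀ {n} → Grid n 0
emptyGrid {n} = replicate n []

chosen-▹-zero : ∀ {n m} (v : Column n) (g : Grid n m) r → chosen (v ▹ g) (r , fzero) ≡ lookup v r
chosen-▹-zero v g r = cong (λ row → lookup row fzero) (lookup-zipWith _∷_ r v g)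

chosen-▹-shift : ∀ {n m} (v : Column n) (g : Grid n m) p → chosen (v ▹ g) (shiftCell p) ≡ chosen g p
chosen-▹-shift v g (r , c) = cong (λ row → lookup row (fsuc c)) (lookup-zipWith _∷_ r v g)

apart : ∀ {n m} → ℕ → Grid n m → Cell n m → Cell n m → Bool
apart s g p q = not (chosen g p ∧ chosen g q ∧ not (sameCell p q) ∧ overlaps s p q)

inside : ∀ {n m} → ℕ → Grid n m → Bool
inside {n} {m} s g = allᵇ (λ p → not (chosen g p) ∨ fits n m s p) (cells n m)

disjoint : ∀ {n m} → ℕ → Grid n m → Bool
disjoint {n} {m} s g = allᵇ (λ pq → apart s g (proj₁ pq) (proj₂ pq)) (cartesianProduct (cells n m) (cells n m))

insideColumn : ∀ {n} → ℕ → ℕ → Column n → Bool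
insideColumn {n} s m v = allᵇ (λ r → not (lookup v r) ∨ fits n (suc m) s (r , fzero {m})) (allFin n)

columnApart : ∀ {n} → ℕ → Column n → Bool
columnApart {n} s v =
  allᵇ (λ i → allᵇ (λ j → apart s (v ▹ emptyGrid) (i , fzero) (j , fzero)) (allFin n)) (allFin n)

crossApart : ∀ {n m} → ℕ → Column n → Grid n m → Bool
crossApart {n} {m} s u g =
  allᵇ (λ i → allᵇ (λ p → apart s (u ▹ g) (i , fzero) (shiftCell p) ∧ apart s (u ▹ g) (shiftCell p) (i , fzero))
                   (cells n m))
       (allFin n)

weight : ∀ {n} → Column n → ℕ
weight {n} v = count (lookup v) (allFin n)

inside-▹ : ∀ {n m} s (v : Column n) (g : Grid n m) → inside s (v ▹ g) ≡ insideColumn s m v ∧ inside s g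
inside-▹ {n} {m} s v g =
  trans (⋀.⨁-cells-suc {n} {m} _) (cong₂ _∧_ (⋀.⨁-cong firstColumn (allFin n)) (⋀.⨁-cong shifted (cells n m)))
  where
  firstColumn : ∀ r → (not (chosen (v ▹ g) (r , fzero)) ∨ fits n (suc m) s (r , fzero {m}))
                    ≡ (not (lookup v r) ∨ fits n (suc m) s (r , fzero {m}))
  firstColumn r = cong (λ b → not b ∨ _) (chosen-▹-zero v g r)
  shifted : ∀ p → (not (chosen (v ▹ g) (shiftCell p)) ∨ fits n (suc m) s (shiftCell p))
                ≡ (not (chosen g p) ∨ fits n m s p)
  shifted (r , c) = cong₂ (λ b f → not b ∨ f) (chosen-▹-shift v g (r , c))
                          (cong ((toℕ r + s ≤ᵇ n) ∧_) (suc-≤ᵇ-suc (toℕ c + s) m))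

apart-▹-zero : ∀ {n m m′} s (v : Column n) (g : Grid n m) (h : Grid n m′) i j →
               apart s (v ▹ g) (i , fzero) (j , fzero) ≡ apart s (v ▹ h) (i , fzero) (j , fzero)
apart-▹-zero s v g h i j
  rewrite chosen-▹-zero v g i | chosen-▹-zero v g j | chosen-▹-zero v h i | chosen-▹-zero v h j = refl

apart-▹-shift : ∀ {n m} s (v : Column n) (g : Grid n m) p q →
                apart s (v ▹ g) (shiftCell p) (shiftCell q) ≡ apart s g p q
apart-▹-shift s v g (r , c) (r′ , c′)
  rewrite chosen-▹-shift v g (r , c) | chosen-▹-shift v g (r′ , c′) = refl

disjoint-▹ : ∀ {n m} s (v : Column n) (g : Grid n m) →
             disjoint s (v ▹ g) ≡ columnApart s v ∧ (crossApart s v g ∧ disjoint s g)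
disjoint-▹ {n} {m} s v g = begin
  disjoint s (v ▹ g)
    ≡⟨ ⋀.⨁-cartesianProduct _ C C ⟩
  ⋀.⨁ (λ x → ⋀.⨁ (Q x) C) C
    ≡⟨ ⋀.⨁-cong (λ x → ⋀.⨁-cells-suc (Q x)) C ⟩
  ⋀.⨁ (λ x → ⋀.⨁ (λ j → Q x (j , fzero)) R ∧ ⋀.⨁ (Q x ∘ shiftCell) C′) C
    ≡⟨ ⋀.⨁-∙ _ _ C ⟩
  ⋀.⨁ (λ x → ⋀.⨁ (λ j → Q x (j , fzero)) R) C ∧ ⋀.⨁ (λ x → ⋀.⨁ (Q x ∘ shiftCell) C′) C
    ≡⟨ cong₂ _∧_ (⋀.⨁-cells-suc {n} {m} _) (⋀.⨁-cells-suc {n} {m} _) ⟩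
  (α ∧ β) ∧ (γ ∧ δ)
    ≡⟨ solve 4 (λ α β γ δ → (α ⊕ β) ⊕ (γ ⊕ δ) ⊜ α ⊕ ((γ ⊕ β) ⊕ δ)) refl α β γ δ ⟩
  α ∧ ((γ ∧ β) ∧ δ)
    ≡⟨ cong₂ (λ a b → a ∧ (b ∧ δ)) α≡ γβ≡ ⟩
  columnApart s v ∧ (crossApart s v g ∧ δ)
    ≡⟨ cong (λ d → columnApart s v ∧ (crossApart s v g ∧ d)) δ≡ ⟩
  columnApart s v ∧ (crossApart s v g ∧ disjoint s g) ∎
  where
  open ≡-Reasoning
  open import Algebra.Solver.CommutativeMonoid ∧-commutativeMonoid using (solve; _⊜_; _⊕_)
  C = cells n (suc m)
  C′ = cells n m
  R = allFin n
  Q = apart s (v ▹ g)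
  α = ⋀.⨁ (λ i → ⋀.⨁ (λ j → Q (i , fzero) (j , fzero)) R) R
  β = ⋀.⨁ (λ x → ⋀.⨁ (λ j → Q (shiftCell x) (j , fzero)) R) C′
  γ = ⋀.⨁ (λ i → ⋀.⨁ (Q (i , fzero) ∘ shiftCell) C′) R
  δ = ⋀.⨁ (λ x → ⋀.⨁ (Q (shiftCell x) ∘ shiftCell) C′) C′
  α≡ : α ≡ columnApart s v
  α≡ = ⋀.⨁-cong (λ i → ⋀.⨁-cong (apart-▹-zero s v g emptyGrid i) R) R
  γβ≡ : γ ∧ β ≡ crossApart s v g
  γβ≡ = sym (begin
    crossApart s v g
      ≡⟨ ⋀.⨁-cong (λ i → ⋀.⨁-∙ (Q (i , fzero) ∘ shiftCell) (λ x → Q (shiftCell x) (i , fzero)) C′) R ⟩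
    ⋀.⨁ (λ i → ⋀.⨁ (Q (i , fzero) ∘ shiftCell) C′ ∧ ⋀.⨁ (λ x → Q (shiftCell x) (i , fzero)) C′) R
      ≡⟨ ⋀.⨁-∙ (λ i → ⋀.⨁ (Q (i , fzero) ∘ shiftCell) C′) _ R ⟩
    γ ∧ ⋀.⨁ (λ i → ⋀.⨁ (λ x → Q (shiftCell x) (i , fzero)) C′) R
      ≡⟨ cong (γ ∧_) (⋀.⨁-comm _ R C′) ⟩
    γ ∧ β ∎)
  δ≡ : δ ≡ disjoint s g
  δ≡ = trans (⋀.⨁-cong (λ x → ⋀.⨁-cong (apart-▹-shift s v g x) C′) C′)
             (sym (⋀.⨁-cartesianProduct (λ pq → apart s g (proj₁ pq) (proj₂ pq)) C′ C′))

apart-far : ∀ {n m} (g : Grid n (suc (suc m))) i p →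
            apart 2 g (i , fzero) (shiftCell (shiftCell p)) ∧ apart 2 g (shiftCell (shiftCell p)) (i , fzero) ≡ true
apart-far g i (r , c) = cong₂ _∧_
  (not-∧-false (chosen g (i , fzero)) (chosen g q) (not (sameCell (i , fzero) q)) (toℕ i <ᵇ toℕ r + 2) (toℕ r <ᵇ toℕ i + 2))
  (not-∧-false (chosen g q) (chosen g (i , fzero)) (not (sameCell q (i , fzero))) (toℕ r <ᵇ toℕ i + 2) (toℕ i <ᵇ toℕ r + 2))
  where q = r , fsuc (fsuc c)

crossApart-▹ : ∀ {n m m′} (u v : Column n) (g : Grid n m) (h : Grid n m′) →
               crossApart 2 u (v ▹ g) ≡ crossApart 2 u (v ▹ h)
crossApart-▹ {n} u v g h = begin
  crossApart 2 u (v ▹ g)           ≡⟨ adjacentColumn g ⟩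
  ⋀.⨁ (λ i → ⋀.⨁ (S g i) R) R     ≡⟨ ⋀.⨁-cong (λ i → ⋀.⨁-cong (S-independent i) R) R ⟩
  ⋀.⨁ (λ i → ⋀.⨁ (S h i) R) R     ≡⟨ sym (adjacentColumn h) ⟩
  crossApart 2 u (v ▹ h)           ∎
  where
  open ≡-Reasoning
  R = allFin n
  S : ∀ {k} → Grid n k → Fin n → Fin n → Bool
  S g i j = apart 2 (u ▹ v ▹ g) (i , fzero) (j , fsuc fzero) ∧ apart 2 (u ▹ v ▹ g) (j , fsuc fzero) (i , fzero)
  adjacentColumn : ∀ {k} (g : Grid n k) → crossApart 2 u (v ▹ g) ≡ ⋀.⨁ (λ i → ⋀.⨁ (S g i) R) R
  adjacentColumn {k} g = ⋀.⨁-cong (λ i → begin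
    ⋀.⨁ (λ p → apart 2 (u ▹ v ▹ g) (i , fzero) (shiftCell p) ∧ apart 2 (u ▹ v ▹ g) (shiftCell p) (i , fzero)) (cells n (suc k))
      ≡⟨ ⋀.⨁-cells-suc {n} {k} _ ⟩
    ⋀.⨁ (S g i) R ∧ ⋀.⨁ (λ p → apart 2 (u ▹ v ▹ g) (i , fzero) (shiftCell (shiftCell p))
                                 ∧ apart 2 (u ▹ v ▹ g) (shiftCell (shiftCell p)) (i , fzero)) (cells n k)
      ≡⟨ cong (⋀.⨁ (S g i) R ∧_) (trans (⋀.⨁-cong (apart-far (u ▹ v ▹ g) i) (cells n k)) (⋀.⨁-ε (cells n k))) ⟩
    ⋀.⨁ (S g i) R ∧ true
      ≡⟨ ∧-identityʳ _ ⟩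
    ⋀.⨁ (S g i) R ∎) R
  S-independent : ∀ i j → S g i j ≡ S h i j
  S-independent i j
    rewrite chosen-▹-zero u (v ▹ g) i | chosen-▹-shift u (v ▹ g) (j , fzero) | chosen-▹-zero v g j
          | chosen-▹-zero u (v ▹ h) i | chosen-▹-shift u (v ▹ h) (j , fzero) | chosen-▹-zero v h j = refl

numChosen-▹ : ∀ {n m} (v : Column n) (g : Grid n m) → numChosen (v ▹ g) ≡ weight v + numChosen g
numChosen-▹ {n} {m} v g = begin
  numChosen (v ▹ g)
    ≡⟨ length-filterᵇ _ (cells n (suc m)) ⟩
  count (chosen (v ▹ g)) (cells n (suc m))
    ≡⟨ ∑.⨁-cells-suc {n} {m} _ ⟩
  count (λ r → chosen (v ▹ g) (r , fzero)) (allFin n) + count (chosen (v ▹ g) ∘ shiftCell) (cells n m)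
    ≡⟨ cong₂ _+_ (∑.⨁-cong (cong indicator ∘ chosen-▹-zero v g) (allFin n))
                 (∑.⨁-cong (cong indicator ∘ chosen-▹-shift v g) (cells n m)) ⟩
  weight v + count (chosen g) (cells n m)
    ≡⟨ cong (_+_ (weight v)) (sym (length-filterᵇ _ (cells n m))) ⟩
  weight v + numChosen g ∎
  where open ≡-Reasoning

compatible : ∀ {n} → Column n → Column n → Bool
compatible u v = crossApart 2 u (v ▹ emptyGrid)

tilingAfter : ∀ {n m} → Column n → ℕ → Grid n m → Bool
tilingAfter u k g = crossApart 2 u g ∧ (inside 2 g ∧ (disjoint 2 g ∧ (numChosen g ≡ᵇ k)))

tilingsAfter : ∀ {n} → Column n → ℕ → ℕ → ℕ
tilingsAfter {n} u m k = count (tilingAfter u k) (allGrids n m)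

admissible : ∀ {n} → ℕ → Column n → Column n → ℕ → Bool
admissible m u v k = (compatible u v ∧ columnApart 2 v) ∧ (insideColumn 2 m v ∧ (weight v ≤ᵇ k))

tilingAfter-▹ : ∀ {n m} (u v : Column n) k (g : Grid n m) →
                tilingAfter u k (v ▹ g) ≡ admissible m u v k ∧ tilingAfter v (k ∸ weight v) g
tilingAfter-▹ {m = m} u v k g
  rewrite crossApart-▹ u v g emptyGrid | inside-▹ 2 v g | disjoint-▹ 2 v g | numChosen-▹ v g
        | +-≡ᵇ (weight v) (numChosen g) k
  = solve 8 (λ cuv iv ig av cvg dg w e →
               cuv ⊕ ((iv ⊕ ig) ⊕ ((av ⊕ (cvg ⊕ dg)) ⊕ (w ⊕ e)))
             ⊜ ((cuv ⊕ av) ⊕ (iv ⊕ w)) ⊕ (cvg ⊕ (ig ⊕ (dg ⊕ e))))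
          refl (compatible u v) (insideColumn 2 m v) (inside 2 g) (columnApart 2 v) (crossApart 2 v g)
               (disjoint 2 g) (weight v ≤ᵇ k) (numChosen g ≡ᵇ k ∸ weight v)
  where open import Algebra.Solver.CommutativeMonoid ∧-commutativeMonoid using (solve; _⊜_; _⊕_)

tilingAfter-zero : ∀ {n} (u : Column n) k (g : Grid n 0) → tilingAfter u k g ≡ (0 ≡ᵇ k)
tilingAfter-zero {n} u k g
  rewrite ⋀.⨁-cong (λ i → ⋀.⨁-cells-zero {n} (λ p → apart 2 (u ▹ g) (i , fzero) (shiftCell p)
                                                   ∧ apart 2 (u ▹ g) (shiftCell p) (i , fzero))) (allFin n)
        | ⋀.⨁-ε (allFin n)
        | ⋀.⨁-cells-zero {n} (λ p → not (chosen g p) ∨ fits n 0 2 p)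
        | ⋀.⨁-cartesianProduct (λ pq → apart 2 g (proj₁ pq) (proj₂ pq)) (cells n 0) (cells n 0)
        | ⋀.⨁-cells-zero {n} (λ p → ⋀.⨁ (λ q → apart 2 g p q) (cells n 0))
        | length-filterᵇ (chosen g) (cells n 0)
        | ∑.⨁-cells-zero {n} (indicator ∘ chosen g)
  = refl

columns : ∀ n → List (Column n)
columns n = allVecs (true ∷ false ∷ []) n

-- opaque, so that comparing two counts never unfolds the whole recursion
opaque
  transfer : ∀ {n} → ℕ → Column n → ℕ → ℕ
  transfer          zero    u k = indicator (0 ≡ᵇ k)
  transfer {n = n} (suc m) u k =
    ∑.⨁ (λ v → if admissible m u v k then transfer m v (k ∸ weight v) else 0) (columns n)

  transfer-zero : ∀ {n} (u : Column n) k → transfer zero u k ≡ indicator (0 ≡ᵇ k)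
  transfer-zero u k = refl

  transfer-suc : ∀ {n} m (u : Column n) k →
                 transfer (suc m) u k ≡ ∑.⨁ (λ v → if admissible m u v k then transfer m v (k ∸ weight v) else 0) (columns n)
  transfer-suc m u k = refl

tilingsAfter≡transfer : ∀ {n} m (u : Column n) k → tilingsAfter u m k ≡ transfer m u k
tilingsAfter≡transfer {n} zero u k = begin
  count (tilingAfter u k) (allVecs ([] ∷ []) n)  ≡⟨ cong (count (tilingAfter u k)) (allVecs-singleton [] n) ⟩
  indicator (tilingAfter u k emptyGrid) + 0      ≡⟨ cong (λ b → indicator b + 0) (tilingAfter-zero u k emptyGrid) ⟩
  indicator (0 ≡ᵇ k) + 0                         ≡⟨ +-identityʳ _ ⟩
  indicator (0 ≡ᵇ k)                             ≡⟨ sym (transfer-zero u k) ⟩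
  transfer zero u k                              ∎
  where open ≡-Reasoning
tilingsAfter≡transfer {n} (suc m) u k = begin
  count (tilingAfter u k) (allGrids n (suc m))
    ≡⟨ ∑.⨁-allGrids-suc n _ (true ∷ false ∷ []) ⟩
  ∑.⨁ (λ v → count (tilingAfter u k ∘ (v ▹_)) (allGrids n m)) (columns n)
    ≡⟨ ∑.⨁-cong (λ v → ∑.⨁-cong (cong indicator ∘ tilingAfter-▹ u v k) (allGrids n m)) (columns n) ⟩
  ∑.⨁ (λ v → count (λ g → admissible m u v k ∧ tilingAfter v (k ∸ weight v) g) (allGrids n m)) (columns n)
    ≡⟨ ∑.⨁-cong (λ v → count-∧ˡ (admissible m u v k) _ (allGrids n m)) (columns n) ⟩
  ∑.⨁ (λ v → if admissible m u v k then tilingsAfter v m (k ∸ weight v) else 0) (columns n)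
    ≡⟨ ∑.⨁-cong (λ v → cong (λ t → if admissible m u v k then t else 0)
                            (tilingsAfter≡transfer m v (k ∸ weight v))) (columns n) ⟩
  ∑.⨁ (λ v → if admissible m u v k then transfer m v (k ∸ weight v) else 0) (columns n)
    ≡⟨ sym (transfer-suc m u k) ⟩
  transfer (suc m) u k ∎
  where open ≡-Reasoning

Tnm≡transfer : ∀ n m k → Tnm n m 2 k ≡ transfer m (replicate n false) k
Tnm≡transfer n m k = trans (length-filterᵇ _ (allGrids n m))
  (trans (∑.⨁-cong (λ g → cong (λ b → indicator (b ∧ isTiling n m 2 k g)) (sym (crossApart-empty g))) (allGrids n m))
         (tilingsAfter≡transfer m (replicate n false) k))
  where
  crossApart-empty : (g : Grid n m) → crossApart 2 (replicate n false) g ≡ true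
  crossApart-empty g =
    trans (⋀.⨁-cong (λ i → trans (⋀.⨁-cong (noCorner i) (cells n m)) (⋀.⨁-ε (cells n m))) (allFin n)) (⋀.⨁-ε (allFin n))
    where
    noCorner : ∀ i p → apart 2 (replicate n false ▹ g) (i , fzero) (shiftCell p)
                       ∧ apart 2 (replicate n false ▹ g) (shiftCell p) (i , fzero) ≡ true
    noCorner i p rewrite chosen-▹-zero (replicate n false) g i | lookup-replicate i false
                       | ∧-zeroʳ (chosen (replicate n false ▹ g) (shiftCell p)) = refl

-- Convolution with a polynomial of degree at most 3 in each variable

sumTo-cong≤ : ∀ n {f g : ℕ → ℤ} → (∀ i → i ≤ n → f i ≡ g i) → sumTo n f ≡ sumTo n g
sumTo-cong≤ zero    f≡g = f≡g 0 z≤n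
sumTo-cong≤ (suc n) f≡g = cong₂ ℤ._+_ (sumTo-cong≤ n (λ i i≤n → f≡g i (m≤n⇒m≤1+n i≤n))) (f≡g (suc n) ≤-refl)

sumTo-cong : ∀ n {f g : ℕ → ℤ} → (∀ i → f i ≡ g i) → sumTo n f ≡ sumTo n g
sumTo-cong n f≡g = sumTo-cong≤ n (λ i _ → f≡g i)

sumTo-unfoldˡ : ∀ n (f : ℕ → ℤ) → sumTo (suc n) f ≡ f 0 ℤ.+ sumTo n (f ∘ suc)
sumTo-unfoldˡ zero    f = refl
sumTo-unfoldˡ (suc n) f = trans (cong (ℤ._+ f (2 + n)) (sumTo-unfoldˡ n f)) (ℤP.+-assoc (f 0) _ _)

sumTo-reverse : ∀ n (f : ℕ → ℤ) → sumTo n f ≡ sumTo n (λ i → f (n ∸ i))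
sumTo-reverse zero    f = refl
sumTo-reverse (suc n) f = begin
  sumTo n f ℤ.+ f (suc n)                  ≡⟨ cong (ℤ._+ f (suc n)) (sumTo-reverse n f) ⟩
  sumTo n (λ i → f (n ∸ i)) ℤ.+ f (suc n)  ≡⟨ ℤP.+-comm _ (f (suc n)) ⟩
  f (suc n) ℤ.+ sumTo n (λ i → f (n ∸ i))  ≡⟨ sym (sumTo-unfoldˡ n (λ i → f (suc n ∸ i))) ⟩
  sumTo (suc n) (λ i → f (suc n ∸ i))      ∎
  where open ≡-Reasoning

sumTo-vanishing : ∀ n j (f : ℕ → ℤ) → (∀ i → f (suc (n + i)) ≡ +0) → sumTo (n + j) f ≡ sumTo n f
sumTo-vanishing n zero    f f≡0 = cong (λ l → sumTo l f) (+-identityʳ n)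
sumTo-vanishing n (suc j) f f≡0 = begin
  sumTo (n + suc j) f                 ≡⟨ cong (λ l → sumTo l f) (+-suc n j) ⟩
  sumTo (n + j) f ℤ.+ f (suc (n + j)) ≡⟨ cong₂ ℤ._+_ (sumTo-vanishing n j f f≡0) (f≡0 j) ⟩
  sumTo n f ℤ.+ +0                    ≡⟨ ℤP.+-identityʳ _ ⟩
  sumTo n f                           ∎
  where open ≡-Reasoning

antidiagonal-window : ∀ N n (h : ℕ → ℕ → ℤ) → (∀ i x → h i (suc (N + x)) ≡ +0) →
  sumTo n (λ i → h i (n ∸ i)) ≡ sumTo N (λ d → if d ≤ᵇ n then h (n ∸ d) d else +0)
antidiagonal-window N n h h≡0 = begin
  sumTo n (λ i → h i (n ∸ i))           ≡⟨ sumTo-reverse n _ ⟩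
  sumTo n (λ d → h (n ∸ d) (n ∸ (n ∸ d))) ≡⟨ sumTo-cong≤ n reindex ⟩
  sumTo n u                             ≡⟨ sym (sumTo-vanishing n N u beyond-n) ⟩
  sumTo (n + N) u                       ≡⟨ cong (λ l → sumTo l u) (+-comm n N) ⟩
  sumTo (N + n) u                       ≡⟨ sumTo-vanishing N n u beyond-N ⟩
  sumTo N u                             ∎
  where
  open ≡-Reasoning
  u : ℕ → ℤ
  u d = if d ≤ᵇ n then h (n ∸ d) d else +0
  reindex : ∀ d → d ≤ n → h (n ∸ d) (n ∸ (n ∸ d)) ≡ u d
  reindex d d≤n rewrite ≤⇒≤ᵇ≡true d≤n = cong (h (n ∸ d)) (m∸[m∸n]≡n d≤n)
  beyond-n : ∀ i → u (suc (n + i)) ≡ +0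
  beyond-n i rewrite suc[n+i]≤ᵇn≡false n i = refl
  beyond-N : ∀ i → u (suc (N + i)) ≡ +0
  beyond-N i with suc (N + i) ≤ᵇ n
  ... | true  = h≡0 (n ∸ suc (N + i)) i
  ... | false = refl

⋆-window : (f g : Series) → (∀ d x → g d (4 + x) ≡ +0) → (∀ x e → g (4 + x) e ≡ +0) → ∀ M K →
  (f ⋆ g) M K ≡ sumTo 3 (λ d → if d ≤ᵇ M then sumTo 3 (λ e → if e ≤ᵇ K then f (M ∸ d) (K ∸ e) ℤ.* g d e else +0) else +0)
⋆-window f g g≡0ᵉ g≡0ᵈ M K = trans
  (sumTo-cong M (λ i → antidiagonal-window 3 K (λ j e → f i j ℤ.* g (M ∸ i) e)
                                              (λ j x → trans (cong (f i j ℤ.*_) (g≡0ᵉ (M ∸ i) x)) (ℤP.*-zeroʳ (f i j)))))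
  (antidiagonal-window 3 M H H≡0)
  where
  H : ℕ → ℕ → ℤ
  H i d = sumTo 3 (λ e → if e ≤ᵇ K then f i (K ∸ e) ℤ.* g d e else +0)
  H≡0 : ∀ i x → H i (4 + x) ≡ +0
  H≡0 i x = sumTo-cong 3 term≡0
    where
    term≡0 : ∀ e → (if e ≤ᵇ K then f i (K ∸ e) ℤ.* g (4 + x) e else +0) ≡ +0
    term≡0 e with e ≤ᵇ K
    ... | true  = trans (cong (f i (K ∸ e) ℤ.*_) (g≡0ᵈ x e)) (ℤP.*-zeroʳ (f i (K ∸ e)))
    ... | false = refl

-- coefficient of z^M t^K in z^d t^e F, where F = Σ f m k z^m t^k
shift : ℕ → ℕ → (ℕ → ℕ → ℕ) → ℕ → ℕ → ℕ
shift d e f M K = if d ≤ᵇ M then (if e ≤ᵇ K then f (M ∸ d) (K ∸ e) else 0) else 0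

-- Strips of four rows

noSquare top middle bottom topAndBottom : Column 4
noSquare     = false ∷ false ∷ false ∷ false ∷ []
top          = true  ∷ false ∷ false ∷ false ∷ []
middle       = false ∷ true  ∷ false ∷ false ∷ []
bottom       = false ∷ false ∷ true  ∷ false ∷ []
topAndBottom = true  ∷ false ∷ true  ∷ false ∷ []

opaque
  unfolding transfer
  from-noSquare₀ : ∀ m → transfer (2 + m) noSquare 0 ≡ transfer (1 + m) noSquare 0 + 0
  from-noSquare₀ m = refl

  from-noSquare₁ : ∀ m → transfer (2 + m) noSquare 1
    ≡ transfer (1 + m) top 0 + (transfer (1 + m) middle 0 + (transfer (1 + m) bottom 0 + (transfer (1 + m) noSquare 1 + 0)))
  from-noSquare₁ m = refl

  from-noSquare : ∀ m k → transfer (2 + m) noSquare (2 + k)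
    ≡ transfer (1 + m) topAndBottom k + (transfer (1 + m) top (1 + k) + (transfer (1 + m) middle (1 + k)
      + (transfer (1 + m) bottom (1 + k) + (transfer (1 + m) noSquare (2 + k) + 0))))
  from-noSquare m k = refl

  from-middle : ∀ m k → transfer (suc m) middle k ≡ transfer m noSquare k + 0
  from-middle m k = refl

  from-topAndBottom : ∀ m k → transfer (suc m) topAndBottom k ≡ transfer m noSquare k + 0
  from-topAndBottom m k = refl

  from-top₀ : ∀ m → transfer (2 + m) top 0 ≡ transfer (1 + m) noSquare 0 + 0
  from-top₀ m = refl

  from-top : ∀ m k → transfer (2 + m) top (1 + k) ≡ transfer (1 + m) bottom k + (transfer (1 + m) noSquare (1 + k) + 0)
  from-top m k = refl

  from-bottom₀ : ∀ m → transfer (2 + m) bottom 0 ≡ transfer (1 + m) noSquare 0 + 0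
  from-bottom₀ m = refl

  from-bottom : ∀ m k → transfer (2 + m) bottom (1 + k) ≡ transfer (1 + m) top k + (transfer (1 + m) noSquare (1 + k) + 0)
  from-bottom m k = refl

flat notched : ℕ → ℕ → ℕ
flat    m k = transfer m noSquare k
notched m k = transfer m top k + transfer m bottom k

flat-step-regroup : ∀ t b f f′ f″ → (f′ + 0) + (t + ((f″ + 0) + (b + (f + 0)))) ≡ f + (f′ + (f″ + (t + b)))
flat-step-regroup = ℕ-Solver.solve-∀

notched-step-regroup : ∀ t b f → (b + (f + 0)) + (t + (f + 0)) ≡ (t + b) + 2 * f
notched-step-regroup = ℕ-Solver.solve-∀

flat-step : ∀ m K → flat (2 + m) K
  ≡ shift 1 0 flat (2 + m) K + (shift 2 2 flat (2 + m) K + (shift 2 1 flat (2 + m) K + shift 1 1 notched (2 + m) K))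
flat-step m zero = from-noSquare₀ m
flat-step m (suc zero) rewrite from-noSquare₁ m | from-middle m 0 =
  flat-step-regroup (T top 0) (T bottom 0) (T noSquare 1) 0 (flat m 0)
  where T = transfer (1 + m)
flat-step m (suc (suc k)) rewrite from-noSquare m k | from-topAndBottom m k | from-middle m (1 + k) =
  flat-step-regroup (T top (1 + k)) (T bottom (1 + k)) (T noSquare (2 + k)) (flat m k) (flat m (1 + k))
  where T = transfer (1 + m)

notched-step : ∀ m K → notched (2 + m) K ≡ shift 1 1 notched (2 + m) K + 2 * flat (1 + m) K
notched-step m zero rewrite from-top₀ m | from-bottom₀ m = notched-step-regroup 0 0 (flat (1 + m) 0)
notched-step m (suc k) rewrite from-top m k | from-bottom m k =
  notched-step-regroup (T top k) (T bottom k) (T noSquare (1 + k))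
  where T = transfer (1 + m)

eliminate-notched : ∀ {x x₁₁ y₁₁} x₁₀ x₂₁ x₂₂ x₃₂ x₃₃ y₂₂ →
  x ≡ x₁₀ + (x₂₂ + (x₂₁ + y₁₁)) → y₁₁ ≡ y₂₂ + 2 * x₂₁ → x₁₁ ≡ x₂₁ + (x₃₃ + (x₃₂ + y₂₂)) →
  x + (x₃₂ + x₃₃) ≡ x₁₀ + (x₁₁ + (2 * x₂₁ + x₂₂))
eliminate-notched x₁₀ x₂₁ x₂₂ x₃₂ x₃₃ y₂₂ refl refl refl = identity x₁₀ x₂₁ x₂₂ x₃₂ x₃₃ y₂₂
  where
  identity : ∀ x₁₀ x₂₁ x₂₂ x₃₂ x₃₃ y₂₂ → x₁₀ + (x₂₂ + (x₂₁ + (y₂₂ + 2 * x₂₁))) + (x₃₂ + x₃₃)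
                                         ≡ x₁₀ + (x₂₁ + (x₃₃ + (x₃₂ + y₂₂)) + (2 * x₂₁ + x₂₂))
  identity = ℕ-Solver.solve-∀

window-balance : ∀ m K → let â = λ d e → shift d e flat (3 + m) K in
  â 0 0 + (â 3 2 + â 3 3) ≡ â 1 0 + (â 1 1 + (2 * â 2 1 + â 2 2))
window-balance m K =
  eliminate-notched (â 1 0) (â 2 1) (â 2 2) (â 3 2) (â 3 3) (shift 2 2 notched (3 + m) K)
                    (flat-step (1 + m) K) (notched-step₁₁ K) (flat-step₁₁ K)
  where
  â : ℕ → ℕ → ℕ
  â d e = shift d e flat (3 + m) K
  notched-step₁₁ : ∀ K → shift 1 1 notched (3 + m) K ≡ shift 2 2 notched (3 + m) K + 2 * shift 2 1 flat (3 + m) K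
  notched-step₁₁ zero    = refl
  notched-step₁₁ (suc k) = notched-step m k
  flat-step₁₁ : ∀ K → shift 1 1 flat (3 + m) K
    ≡ shift 2 1 flat (3 + m) K + (shift 3 3 flat (3 + m) K + (shift 3 2 flat (3 + m) K + shift 2 2 notched (3 + m) K))
  flat-step₁₁ zero    = refl
  flat-step₁₁ (suc k) = flat-step m k

-- the coefficient of z^M t^K in Den · Σ flat m k z^m t^k
windowSum : ℕ → ℕ → ℤ
windowSum M K = â 0 0 ℤ.- â 1 0 ℤ.- â 1 1 ℤ.- + 2 ℤ.* â 2 1 ℤ.- â 2 2 ℤ.+ â 3 2 ℤ.+ â 3 3
  where
  â : ℕ → ℕ → ℤ
  â d e = + shift d e flat M K

balance⇒difference≡0 : ∀ a b c d e f g → a + (f + g) ≡ b + (c + (2 * d + e)) →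
  + a ℤ.- + b ℤ.- + c ℤ.- + 2 ℤ.* + d ℤ.- + e ℤ.+ + f ℤ.+ + g ≡ +0
balance⇒difference≡0 a b c d e f g balance = begin
  + a ℤ.- + b ℤ.- + c ℤ.- + 2 ℤ.* + d ℤ.- + e ℤ.+ + f ℤ.+ + g
    ≡⟨ regroup (+ a) (+ b) (+ c) (+ d) (+ e) (+ f) (+ g) ⟩
  (+ a ℤ.+ (+ f ℤ.+ + g)) ℤ.- (+ b ℤ.+ (+ c ℤ.+ (+ 2 ℤ.* + d ℤ.+ + e)))
    ≡⟨ cong₂ ℤ._-_ (sym (lhs≡)) (sym rhs≡) ⟩
  + (a + (f + g)) ℤ.- + (b + (c + (2 * d + e)))
    ≡⟨ cong (λ x → + x ℤ.- + (b + (c + (2 * d + e)))) balance ⟩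
  + (b + (c + (2 * d + e))) ℤ.- + (b + (c + (2 * d + e)))
    ≡⟨ ℤP.+-inverseʳ (+ (b + (c + (2 * d + e)))) ⟩
  +0 ∎
  where
  open ≡-Reasoning
  regroup : ∀ A B C D E F G → A ℤ.- B ℤ.- C ℤ.- + 2 ℤ.* D ℤ.- E ℤ.+ F ℤ.+ G
                            ≡ (A ℤ.+ (F ℤ.+ G)) ℤ.- (B ℤ.+ (C ℤ.+ (+ 2 ℤ.* D ℤ.+ E)))
  regroup = ℤ-Solver.solve-∀
  lhs≡ : + (a + (f + g)) ≡ + a ℤ.+ (+ f ℤ.+ + g)
  lhs≡ = trans (ℤP.pos-+ a (f + g)) (cong (ℤ._+_ (+ a)) (ℤP.pos-+ f g))
  rhs≡ : + (b + (c + (2 * d + e))) ≡ + b ℤ.+ (+ c ℤ.+ (+ 2 ℤ.* + d ℤ.+ + e))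
  rhs≡ = trans (ℤP.pos-+ b _) (cong (ℤ._+_ (+ b)) (trans (ℤP.pos-+ c _)
           (cong (ℤ._+_ (+ c)) (trans (ℤP.pos-+ (2 * d) e) (cong (ℤ._+ + e) (ℤP.pos-* 2 d))))))

opaque
  unfolding transfer
  windowSum≡Num-narrow : ∀ M K → M ≤ 2 → windowSum M K ≡ Num M K
  windowSum≡Num-narrow 0 0                   _ = refl
  windowSum≡Num-narrow 0 (suc K)             _ = refl
  windowSum≡Num-narrow 1 0                   _ = refl
  windowSum≡Num-narrow 1 1                   _ = refl
  windowSum≡Num-narrow 1 (suc (suc K))       _ = refl
  windowSum≡Num-narrow 2 0                   _ = refl
  windowSum≡Num-narrow 2 1                   _ = refl
  windowSum≡Num-narrow 2 2                   _ = refl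
  windowSum≡Num-narrow 2 (suc (suc (suc K))) _ = refl
  windowSum≡Num-narrow (suc (suc (suc M))) K (s≤s (s≤s ()))

windowSum≡Num : ∀ M K → windowSum M K ≡ Num M K
windowSum≡Num 0                     K = windowSum≡Num-narrow 0 K z≤n
windowSum≡Num 1                     K = windowSum≡Num-narrow 1 K (s≤s z≤n)
windowSum≡Num 2                     K = windowSum≡Num-narrow 2 K (s≤s (s≤s z≤n))
windowSum≡Num (suc (suc (suc m)))   K =
  balance⇒difference≡0 (â 0 0) (â 1 0) (â 1 1) (â 2 1) (â 2 2) (â 3 2) (â 3 3) (window-balance m K)
  where
  â : ℕ → ℕ → ℕ
  â d e = shift d e flat (3 + m) K

Den-expansion : (x : ℕ → ℕ → ℤ) → sumTo 3 (λ d → sumTo 3 (λ e → x d e ℤ.* Den d e))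
  ≡ x 0 0 ℤ.- x 1 0 ℤ.- x 1 1 ℤ.- + 2 ℤ.* x 2 1 ℤ.- x 2 2 ℤ.+ x 3 2 ℤ.+ x 3 3
Den-expansion x = expand (x 0 0) (x 0 1) (x 0 2) (x 0 3) (x 1 0) (x 1 1) (x 1 2) (x 1 3)
                         (x 2 0) (x 2 1) (x 2 2) (x 2 3) (x 3 0) (x 3 1) (x 3 2) (x 3 3)
  where
  expand : ∀ x₀₀ x₀₁ x₀₂ x₀₃ x₁₀ x₁₁ x₁₂ x₁₃ x₂₀ x₂₁ x₂₂ x₂₃ x₃₀ x₃₁ x₃₂ x₃₃ →
      (((x₀₀ ℤ.* Den 0 0 ℤ.+ x₀₁ ℤ.* Den 0 1) ℤ.+ x₀₂ ℤ.* Den 0 2) ℤ.+ x₀₃ ℤ.* Den 0 3)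
    ℤ.+ (((x₁₀ ℤ.* Den 1 0 ℤ.+ x₁₁ ℤ.* Den 1 1) ℤ.+ x₁₂ ℤ.* Den 1 2) ℤ.+ x₁₃ ℤ.* Den 1 3)
    ℤ.+ (((x₂₀ ℤ.* Den 2 0 ℤ.+ x₂₁ ℤ.* Den 2 1) ℤ.+ x₂₂ ℤ.* Den 2 2) ℤ.+ x₂₃ ℤ.* Den 2 3)
    ℤ.+ (((x₃₀ ℤ.* Den 3 0 ℤ.+ x₃₁ ℤ.* Den 3 1) ℤ.+ x₃₂ ℤ.* Den 3 2) ℤ.+ x₃₃ ℤ.* Den 3 3)
    ≡ x₀₀ ℤ.- x₁₀ ℤ.- x₁₁ ℤ.- + 2 ℤ.* x₂₁ ℤ.- x₂₂ ℤ.+ x₃₂ ℤ.+ x₃₃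
  expand = ℤ-Solver.solve-∀

Den-vanishes : ∀ d x → Den d (4 + x) ≡ +0
Den-vanishes 0                           x = refl
Den-vanishes 1                           x = refl
Den-vanishes 2                           x = refl
Den-vanishes 3                           x = refl
Den-vanishes (suc (suc (suc (suc d)))) x = refl

window-row : ∀ M K d (c : ℕ → ℤ) →
  (if d ≤ᵇ M then sumTo 3 (λ e → if e ≤ᵇ K then F4 (M ∸ d) (K ∸ e) ℤ.* c e else +0) else +0)
  ≡ sumTo 3 (λ e → + shift d e flat M K ℤ.* c e)
window-row M K d c with d ≤ᵇ M
... | false = refl
... | true  = sumTo-cong 3 entry
  where
  entry : ∀ e → (if e ≤ᵇ K then F4 (M ∸ d) (K ∸ e) ℤ.* c e else +0)
                ≡ + (if e ≤ᵇ K then flat (M ∸ d) (K ∸ e) else 0) ℤ.* c e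
  entry e with e ≤ᵇ K
  ... | false = refl
  ... | true  = cong (λ t → + t ℤ.* c e) (Tnm≡transfer 4 (M ∸ d) (K ∸ e))

⋆Den≡windowSum : ∀ M K → (F4 ⋆ Den) M K ≡ windowSum M K
⋆Den≡windowSum M K = begin
  (F4 ⋆ Den) M K
    ≡⟨ ⋆-window F4 Den Den-vanishes (λ _ _ → refl) M K ⟩
  sumTo 3 (λ d → if d ≤ᵇ M then sumTo 3 (λ e → if e ≤ᵇ K then F4 (M ∸ d) (K ∸ e) ℤ.* Den d e else +0) else +0)
    ≡⟨ sumTo-cong 3 (λ d → window-row M K d (Den d)) ⟩
  sumTo 3 (λ d → sumTo 3 (λ e → + shift d e flat M K ℤ.* Den d e))
    ≡⟨ Den-expansion (λ d e → + shift d e flat M K) ⟩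
  windowSum M K ∎
  where open ≡-Reasoning

mainTheorem8 : (m k : ℕ) → (F4 ⋆ Den) m k ≡ Num m k
mainTheorem8 m k = trans (⋆Den≡windowSum m k) (windowSum≡Num m k)
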